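{- Let $G$ be a minimal counterexample to the following statement: "every triangle-free plane graph $H$ with $n$ vertices, $m$ edges and $\lambda$ difficult components contains an induced 2-degenerate subgraph on at least $\frac{6n-m-\lambda}{5}$ vertices". Then $G$ has minimum degree at least three.
   Context: A graph is $k$-degenerate if every nonempty subgraph has a vertex of degree at most $k$. The cube is the 3-regular triangle-free planar graph on 8 vertices consisting of two 4-cycles $v_1v_2v_3v_4v_1$, $u_1u_2u_3u_4u_1$ and edges $v_iu_i$. A graph is difficult if it is connected, every block is a vertex, an edge, or isomorphic to the cube, and any two blocks isomorphic to the cube are vertex-disjoint. A minimal counterexample is a triangle-free plane graph $G$ with the smallest number of vertices such that the maximum number of vertices of an induced 2-degenerate subgraph of $G$ is less than $\frac{6|V(G)|-|E(G)|-\lambda}{5}$, where $\lambda$ is the number of difficult components of $G$. -}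

module Defs where

open import Data.Nat using (ℕ; zero; suc; _+_; _*_; _≤_; _<_; _<ᵇ_; _≡ᵇ_)
open import Data.Fin using (Fin; toℕ)
open import Data.Fin.Subset using (Subset; _∈_; _⊆_; _∩_; _-_; ∣_∣; Nonempty)
open import Data.Bool using (Bool; true; false; T; _∧_; _∨_; not; _xor_)
open import Data.Vec using (Vec; tabulate; sum)
open import Data.List using (List; []; _∷_; length)
open import Data.Bool.ListAction using (any)
open import Data.List.Membership.Propositional using () renaming (_∈_ to _∈ₗ_)
open import Data.List.Relation.Unary.Unique.Propositional using (Unique)
open import Data.Product using (Σ; ∃; ∃₂; _×_; _,_)
open import Data.Sum using (_⊎_)
open import Data.Empty using (⊥)
open import Relation.Nullary using (¬_)
open import Relation.Binary.PropositionalEquality using (_≡_; _≢_)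
open import Function.Bundles using (_⇔_)

record Graph (n : ℕ) : Set where
  field
    adj    : Fin n → Fin n → Bool
    sym    : ∀ u v → adj u v ≡ adj v u
    irrefl : ∀ u → adj u u ≡ false

open Graph public

module _ {n : ℕ} where

  Adj : Graph n → Fin n → Fin n → Set
  Adj G u v = T (adj G u v)

  N : Graph n → Fin n → Subset n
  N G v = tabulate (adj G v)

  deg : Graph n → Fin n → ℕ
  deg G v = ∣ N G v ∣

  degIn : Graph n → Subset n → Fin n → ℕ
  degIn G S v = ∣ N G v ∩ S ∣

  -- number of edges: each edge uv counted once, at its larger endpoint
  edgeCount : Graph n → ℕ
  edgeCount G = sum (tabulate λ v → ∣ tabulate (λ u → adj G v u ∧ (toℕ u <ᵇ toℕ v)) ∣)

  TriangleFree : Graph n → Set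
  TriangleFree G = ∀ u v w → Adj G u v → Adj G v w → Adj G u w → ⊥

  TwoDegenerate : Graph n → Subset n → Set
  TwoDegenerate G S = ∀ T → T ⊆ S → Nonempty T → ∃ λ v → v ∈ T × degIn G T v ≤ 2

  data Walk (G : Graph n) (S : Subset n) : Fin n → Fin n → Set where
    here : ∀ {u} → u ∈ S → Walk G S u u
    step : ∀ {u x w} → u ∈ S → Adj G u x → Walk G S x w → Walk G S u w

  -- G[S] is connected (the empty vertex set counts as connected)
  Connected : Graph n → Subset n → Set
  Connected G S = ∀ u w → u ∈ S → w ∈ S → Walk G S u w

  Component : Graph n → Subset n → Set
  Component G C = Nonempty C × Connected G C ×
                  (∀ D → C ⊆ D → Connected G D → D ⊆ C)

  NoCutVertex : Graph n → Subset n → Set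
  NoCutVertex G B = ∀ v → v ∈ B → Connected G (B - v)

  Block : Graph n → Subset n → Subset n → Set
  Block G S B = B ⊆ S × Nonempty B × Connected G B × NoCutVertex G B ×
                (∀ D → B ⊆ D → D ⊆ S → Connected G D → NoCutVertex G D → D ⊆ B)

-- The cube Q₃ on Fin 8: v₁..v₄ = 0..3, u₁..u₄ = 4..7, two 4-cycles
-- v₁v₂v₃v₄v₁, u₁u₂u₃u₄u₁ and the edges vᵢuᵢ.

cubeEdges : List (ℕ × ℕ)
cubeEdges = (0 , 1) ∷ (1 , 2) ∷ (2 , 3) ∷ (3 , 0) ∷
            (4 , 5) ∷ (5 , 6) ∷ (6 , 7) ∷ (7 , 4) ∷
            (0 , 4) ∷ (1 , 5) ∷ (2 , 6) ∷ (3 , 7) ∷ []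

cubeAdj : Fin 8 → Fin 8 → Bool
cubeAdj i j = any (λ { (a , b) → ((a ≡ᵇ toℕ i) ∧ (b ≡ᵇ toℕ j)) ∨ ((a ≡ᵇ toℕ j) ∧ (b ≡ᵇ toℕ i)) }) cubeEdges

module _ {n : ℕ} where

  IsCube : Graph n → Subset n → Set
  IsCube G B = Σ (Fin 8 → Fin n) λ f →
                 (∀ i j → f i ≡ f j → i ≡ j) ×
                 (∀ i → f i ∈ B) ×
                 (∀ x → x ∈ B → ∃ λ i → f i ≡ x) ×
                 (∀ i j → adj G (f i) (f j) ≡ cubeAdj i j)

  Difficult : Graph n → Subset n → Set
  Difficult G C =
    Nonempty C × Connected G C ×
    (∀ B → Block G C B → ∣ B ∣ ≡ 1 ⊎ ∣ B ∣ ≡ 2 ⊎ IsCube G B) ×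
    (∀ B B′ → Block G C B → Block G C B′ → IsCube G B → IsCube G B′ → B ≢ B′ →
       ∀ x → x ∈ B → x ∈ B′ → ⊥)

  NumDifficult : Graph n → ℕ → Set
  NumDifficult G k = Σ (List (Subset n)) λ Cs →
    Unique Cs × length Cs ≡ k ×
    (∀ C → (C ∈ₗ Cs) ⇔ (Component G C × Difficult G C))

-- Planarity (combinatorial): no K₅ minor and no K₃,₃ minor (Wagner).

module _ {n k : ℕ} where

  record MinorModel (G : Graph n) (h : Fin k → Fin k → Bool) : Set where
    field
      branch    : Fin k → Subset n
      nonempty  : ∀ i → Nonempty (branch i)
      connected : ∀ i → Connected G (branch i)
      disjoint  : ∀ i j → i ≢ j → ∀ x → x ∈ branch i → x ∈ branch j → ⊥
      edges     : ∀ i j → T (h i j) →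
                  ∃₂ λ x y → x ∈ branch i × y ∈ branch j × Adj G x y

K5 : Fin 5 → Fin 5 → Bool
K5 i j = not (toℕ i ≡ᵇ toℕ j)

K33 : Fin 6 → Fin 6 → Bool
K33 i j = (toℕ i <ᵇ 3) xor (toℕ j <ᵇ 3)

Planar : {n : ℕ} → Graph n → Set
Planar G = ¬ MinorModel G K5 × ¬ MinorModel G K33

-- The bound of the theorem: G has an induced 2-degenerate subgraph on at
-- least (6n − m − λ)/5 vertices, written over ℕ as 6n ≤ 5|S| + m + λ.

SatisfiesBound : {n : ℕ} → Graph n → Set
SatisfiesBound {n} G = ∀ k → NumDifficult G k →
  ∃ λ S → TwoDegenerate G S × 6 * n ≤ 5 * ∣ S ∣ + edgeCount G + k

MinimalCounterexample : {n : ℕ} → Graph n → Set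
MinimalCounterexample {n} G =
  TriangleFree G × Planar G × ¬ SatisfiesBound G ×
  (∀ n′ → n′ < n → (H : Graph n′) → TriangleFree H → Planar H → SatisfiesBound H)

{-# OPTIONS --safe #-}
-- Let v be a vertex of degree at most 2 and H = G − v. By minimality H has an
-- induced 2-degenerate subgraph on a set S with 6(n − 1) ≤ 5|S| + e(H) + λ(H). The set S + v
-- is still 2-degenerate in G, e(G) = e(H) + deg v, and λ(H) + 1 ≤ λ(G) + deg v: a difficult
-- component of H containing no neighbour of v stays a difficult component of G, at most deg v
-- of them contain a neighbour of v, and if there are exactly deg v of them, each holding one
-- neighbour, then together with v they form a difficult component of G whose new blocks are
-- the edges at v. Hence G satisfies the bound after all. Counting λ(H) needs decidability of
-- being a difficult component; as we are proving a negation, it may be assumed under ¬¬.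

module Submission where

open import Defs hiding (sym)

open import Data.Bool as Bool using (Bool; true; false; T; _∧_)
open import Data.Bool.Properties using (T-≡)
open import Data.Empty using (⊥-elim) renaming (⊥ to Empty)
open import Data.Fin using (Fin; zero; suc; toℕ; punchIn; punchOut)
open import Data.Fin.Patterns using (0F; 1F; 2F)
open import Data.Fin.Properties
  using (_≟_; punchIn-injective; punchInᵢ≢i; punchIn-punchOut; toℕ-injective)
open import Data.Fin.Subset
  using (Subset; inside; outside; _∈_; _∉_; _⊆_; _∩_; _∪_; _-_; ⋃; ⊥; ⁅_⁆; ∣_∣; Nonempty)
open import Data.Fin.Subset.Properties
  using (_∈?_; nonempty?; ∉⊥; ⊆-antisym; p⊆p∪q; q⊆p∪q; x∈p∪q⁻; p─q⊆p; x∈p∧x≢y⇒x∈p-y; p─⊥≡p;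
         x∈⁅x⁆; x∈⁅y⁆⇒x≡y; ∣⁅x⁆∣≡1; ∣⊥∣≡0; p⊆q⇒∣p∣≤∣q∣; ∣p∩q∣≤∣p∣)
open import Data.List using (List; []; _∷_; length; map; _++_; filter)
open import Data.List.Properties using (length-map; length-++)
open import Data.List.Membership.Propositional using (find; lose) renaming (_∈_ to _∈ₗ_)
open import Data.List.Membership.Propositional.Properties
  using (∈-map⁺; ∈-map⁻; ∈-++⁺ˡ; ∈-++⁺ʳ; ∈-++⁻; ∈-∃++; ∈-filter⁺; ∈-filter⁻)
open import Data.List.Relation.Binary.Subset.Propositional using () renaming (_⊆_ to _⊆ₗ_)
open import Data.List.Relation.Unary.All as All using ([]; _∷_)
open import Data.List.Relation.Unary.AllPairs using ([]; _∷_)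
open import Data.List.Relation.Unary.Any using (Any; here; there; any?)
open import Data.List.Relation.Unary.Unique.Propositional using (Unique)
import Data.List.Relation.Unary.Unique.Propositional.Properties as Unique
open import Data.Nat using (ℕ; zero; suc; _+_; _*_; _≤_; _≤?_; z≤n; s≤s; _<ᵇ_)
open import Data.Nat.Properties
  using (+-0-commutativeMonoid; +-assoc; +-comm; +-suc; *-suc; ≤-refl; ≤-trans; ≤-reflexive;
         +-monoʳ-≤; m≤n⇒m≤1+n; ≤-pred; ≰⇒>; module ≤-Reasoning)
open import Data.Nat.Solver using (module +-*-Solver)
open import Algebra.Properties.CommutativeMonoid.Sum +-0-commutativeMonoid
  using (sum; sum-remove; sum-cong-≗; ∑-distrib-+)
open import Data.Product using (Σ; ∃; ∃₂; _×_; _,_; proj₁; proj₂)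
open import Data.Sum as Sum using (_⊎_; inj₁; inj₂)
import Data.Vec as Vec
open import Data.Vec using ([]; _∷_; here; there; lookup; tabulate; insertAt; removeAt)
open import Data.Vec.Properties
  using ([]=⇒lookup; lookup⇒[]=; lookup∘tabulate; insertAt-punchIn; insertAt-lookup;
         insertAt-removeAt; removeAt-insertAt; ∷-injectiveʳ; ≡-dec)
open import Function using (_∘_; _⇔_; mk⇔; Equivalence)
open import Level using (0ℓ)
open import Relation.Binary.PropositionalEquality
  using (_≡_; _≢_; refl; sym; trans; cong; cong₂; subst; subst₂; module ≡-Reasoning)
open import Relation.Nullary using (¬_; yes; no; contradiction)
open import Relation.Nullary.Decidable using (¬¬-excluded-middle)
open import Relation.Unary using (Pred; Decidable)

x∉p-x : ∀ {n} {p : Subset n} x → x ∉ p - x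
x∉p-x {p = _ ∷ _} zero    ()
x∉p-x {p = _ ∷ _} (suc x) (there x∈p-x) = x∉p-x x x∈p-x

x∈p-y⇒x≢y : ∀ {n} {p : Subset n} {x y} → x ∈ p - y → x ≢ y
x∈p-y⇒x≢y x∈p-x refl = x∉p-x _ x∈p-x

x∈p-y⇒x∈p : ∀ {n} {p : Subset n} {x y} → x ∈ p - y → x ∈ p
x∈p-y⇒x∈p {p = p} {y = y} = p─q⊆p p ⁅ y ⁆

∈-tabulate⁺ : ∀ {n} {f : Fin n → Bool} {x} → T (f x) → x ∈ tabulate f
∈-tabulate⁺ {f = f} {x} fx =
  lookup⇒[]= x (tabulate f) (trans (lookup∘tabulate f x) (Equivalence.to T-≡ fx))

∈-tabulate⁻ : ∀ {n} {f : Fin n → Bool} {x} → x ∈ tabulate f → T (f x)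
∈-tabulate⁻ {f = f} {x} x∈ = Equivalence.from T-≡ (trans (sym (lookup∘tabulate f x)) ([]=⇒lookup x∈))

∈⋃⁻ : ∀ {n} (ps : List (Subset n)) {x} → x ∈ ⋃ ps → Any (x ∈_) ps
∈⋃⁻ []       x∈⋃ = contradiction x∈⋃ ∉⊥
∈⋃⁻ (p ∷ ps) x∈⋃ with x∈p∪q⁻ p (⋃ ps) x∈⋃
... | inj₁ x∈p   = here x∈p
... | inj₂ x∈⋃ps = there (∈⋃⁻ ps x∈⋃ps)

⊆⋃ : ∀ {n} {p : Subset n} {ps} → p ∈ₗ ps → p ⊆ ⋃ ps
⊆⋃ {ps = _ ∷ ps} (here refl) = p⊆p∪q (⋃ ps)
⊆⋃ {ps = q ∷ ps} (there p∈)  = q⊆p∪q q (⋃ ps) ∘ ⊆⋃ p∈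

AtMostOne : ∀ {n} → Subset n → Set
AtMostOne p = ∀ {y z} → y ∈ p → z ∈ p → y ≡ z

∣p∣≤1 : ∀ {n} {p : Subset n} → AtMostOne p → ∣ p ∣ ≤ 1
∣p∣≤1 {n} {p} atMostOne with nonempty? p
... | no  p-empty = ≤-trans (p⊆q⇒∣p∣≤∣q∣ {q = ⊥} (λ x∈p → contradiction (_ , x∈p) p-empty))
                            (≤-trans (≤-reflexive (∣⊥∣≡0 n)) z≤n)
... | yes (x , x∈p) = ≤-trans (p⊆q⇒∣p∣≤∣q∣ (λ y∈p → subst (_∈ ⁅ x ⁆) (atMostOne x∈p y∈p) (x∈⁅x⁆ x)))
                              (≤-reflexive (∣⁅x⁆∣≡1 x))

∣p∣≡1+∣p-x∣ : ∀ {n} {p : Subset n} {x} → x ∈ p → ∣ p ∣ ≡ suc ∣ p - x ∣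
∣p∣≡1+∣p-x∣ {p = inside ∷ p}  here = cong (suc ∘ ∣_∣) (sym (p─⊥≡p p))
∣p∣≡1+∣p-x∣ {p = inside ∷ p}  (there x∈p) = cong suc (∣p∣≡1+∣p-x∣ x∈p)
∣p∣≡1+∣p-x∣ {p = outside ∷ p} (there x∈p) = ∣p∣≡1+∣p-x∣ x∈p

≡1+≤1⇒≡1⊎≡2 : ∀ {k j} → k ≡ suc j → j ≤ 1 → k ≡ 1 ⊎ k ≡ 2
≡1+≤1⇒≡1⊎≡2 refl z≤n       = inj₁ refl
≡1+≤1⇒≡1⊎≡2 refl (s≤s z≤n) = inj₂ refl

∣insertAt-outside∣ : ∀ {n} (p : Subset n) i → ∣ insertAt p i outside ∣ ≡ ∣ p ∣
∣insertAt-outside∣ p             zero    = refl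
∣insertAt-outside∣ (inside ∷ p)  (suc i) = cong suc (∣insertAt-outside∣ p i)
∣insertAt-outside∣ (outside ∷ p) (suc i) = ∣insertAt-outside∣ p i

∣insertAt-inside∣ : ∀ {n} (p : Subset n) i → ∣ insertAt p i inside ∣ ≡ suc ∣ p ∣
∣insertAt-inside∣ p             zero    = refl
∣insertAt-inside∣ (inside ∷ p)  (suc i) = cong suc (∣insertAt-inside∣ p i)
∣insertAt-inside∣ (outside ∷ p) (suc i) = ∣insertAt-inside∣ p i

∣tabulate∩insertAt-outside∣ : ∀ {n} (f : Fin (suc n) → Bool) (q : Subset n) i →
  ∣ tabulate f ∩ insertAt q i outside ∣ ≡ ∣ tabulate (f ∘ punchIn i) ∩ q ∣
∣tabulate∩insertAt-outside∣ f q zero with f zero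
... | true  = refl
... | false = refl
∣tabulate∩insertAt-outside∣ f (s ∷ q) (suc i) with f zero ∧ s
... | true  = cong suc (∣tabulate∩insertAt-outside∣ (f ∘ suc) q i)
... | false = ∣tabulate∩insertAt-outside∣ (f ∘ suc) q i

indicator : Bool → ℕ
indicator true  = 1
indicator false = 0

sum-tabulate : ∀ {n} (f : Fin n → ℕ) → Vec.sum (tabulate f) ≡ sum f
sum-tabulate {zero}  f = refl
sum-tabulate {suc n} f = cong (f zero +_) (sum-tabulate (f ∘ suc))

∣tabulate∣ : ∀ {n} (f : Fin n → Bool) → ∣ tabulate f ∣ ≡ sum (indicator ∘ f)
∣tabulate∣ {zero}  f = refl
∣tabulate∣ {suc n} f with f zero
... | true  = cong suc (∣tabulate∣ (f ∘ suc))
... | false = ∣tabulate∣ (f ∘ suc)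

punchIn-<ᵇ : ∀ {n} (v : Fin (suc n)) (j i : Fin n) →
             (toℕ (punchIn v j) <ᵇ toℕ (punchIn v i)) ≡ (toℕ j <ᵇ toℕ i)
punchIn-<ᵇ zero    j       i       = refl
punchIn-<ᵇ (suc v) zero    zero    = refl
punchIn-<ᵇ (suc v) zero    (suc i) = refl
punchIn-<ᵇ (suc v) (suc j) zero    = refl
punchIn-<ᵇ (suc v) (suc j) (suc i) = punchIn-<ᵇ v j i

indicator-split : ∀ c {a b} → a ≢ b → indicator (c ∧ (a <ᵇ b)) + indicator (c ∧ (b <ᵇ a)) ≡ indicator c
indicator-split false             _   = refl
indicator-split true {zero} {zero} a≢b = contradiction refl a≢b
indicator-split true {zero} {suc b} _  = refl
indicator-split true {suc a} {zero} _  = refl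
indicator-split true {suc a} {suc b} a≢b = indicator-split true (a≢b ∘ cong suc)

module _ {A : Set} where

  unique-⊆⇒length≤ : ∀ {xs ys : List A} → Unique xs → xs ⊆ₗ ys → length xs ≤ length ys
  unique-⊆⇒length≤ {[]}     _                 _     = z≤n
  unique-⊆⇒length≤ {x ∷ xs} (x∉xs ∷ xs-unique) x∷xs⊆ys
    with ys₁ , ys₂ , refl ← ∈-∃++ (x∷xs⊆ys (here refl)) = begin
      suc (length xs)                   ≤⟨ s≤s (unique-⊆⇒length≤ xs-unique xs⊆ys₁++ys₂) ⟩
      suc (length (ys₁ ++ ys₂))         ≡⟨ cong suc (length-++ ys₁) ⟩
      suc (length ys₁ + length ys₂)     ≡⟨ sym (+-suc (length ys₁) (length ys₂)) ⟩
      length ys₁ + length (x ∷ ys₂)     ≡⟨ sym (length-++ ys₁) ⟩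
      length (ys₁ ++ x ∷ ys₂)           ∎
    where
    open ≤-Reasoning
    xs⊆ys₁++ys₂ : xs ⊆ₗ ys₁ ++ ys₂
    xs⊆ys₁++ys₂ {y} y∈xs with ∈-++⁻ ys₁ (x∷xs⊆ys (there y∈xs))
    ... | inj₁ y∈ys₁         = ∈-++⁺ˡ y∈ys₁
    ... | inj₂ (here refl)   = contradiction refl (All.lookup x∉xs y∈xs)
    ... | inj₂ (there y∈ys₂) = ∈-++⁺ʳ ys₁ y∈ys₂

subsets : ∀ n → List (Subset n)
subsets zero    = [] ∷ []
subsets (suc n) = map (inside ∷_) (subsets n) ++ map (outside ∷_) (subsets n)

∈-subsets : ∀ {n} (p : Subset n) → p ∈ₗ subsets n
∈-subsets []            = here refl
∈-subsets (inside ∷ p)  = ∈-++⁺ˡ (∈-map⁺ (inside ∷_) (∈-subsets p))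
∈-subsets (outside ∷ p) = ∈-++⁺ʳ (map (inside ∷_) (subsets _)) (∈-map⁺ (outside ∷_) (∈-subsets p))

subsets-unique : ∀ n → Unique (subsets n)
subsets-unique zero    = [] ∷ []
subsets-unique (suc n) =
  Unique.++⁺ (Unique.map⁺ ∷-injectiveʳ (subsets-unique n))
             (Unique.map⁺ ∷-injectiveʳ (subsets-unique n))
    λ (p∈ , p∈′) → headsDiffer (∈-map⁻ (inside ∷_) p∈) (∈-map⁻ (outside ∷_) p∈′)
  where
  headsDiffer : ∀ {p : Subset (suc n)} → (∃ λ q → q ∈ₗ subsets n × p ≡ inside ∷ q) →
                (∃ λ q → q ∈ₗ subsets n × p ≡ outside ∷ q) → Empty
  headsDiffer (_ , _ , refl) (_ , _ , ())

enumerate : ∀ {n} {P : Pred (Subset n) 0ℓ} → Decidable P →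
            Σ (List (Subset n)) λ ps → Unique ps × (∀ p → (p ∈ₗ ps) ⇔ P p)
enumerate {n} P? =
  filter P? (subsets n) , Unique.filter⁺ P? (subsets-unique n) ,
  λ p → mk⇔ (proj₂ ∘ ∈-filter⁻ P? {xs = subsets n}) (∈-filter⁺ P? (∈-subsets p))

¬¬-decidable : ∀ n (P : Pred (Subset n) 0ℓ) → ¬ ¬ Decidable P
¬¬-decidable zero    P ¬P? = ¬¬-excluded-middle λ P[]? → ¬P? λ { [] → P[]? }
¬¬-decidable (suc n) P ¬P? =
  ¬¬-decidable n (P ∘ (inside ∷_)) λ P-inside? →
  ¬¬-decidable n (P ∘ (outside ∷_)) λ P-outside? →
  ¬P? λ { (inside ∷ p) → P-inside? p ; (outside ∷ p) → P-outside? p }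

elements : ∀ {n} → Subset n → List (Fin n)
elements []            = []
elements (inside ∷ p)  = zero ∷ map suc (elements p)
elements (outside ∷ p) = map suc (elements p)

length-elements : ∀ {n} (p : Subset n) → length (elements p) ≡ ∣ p ∣
length-elements []            = refl
length-elements (inside ∷ p)  = cong suc (trans (length-map suc (elements p)) (length-elements p))
length-elements (outside ∷ p) = trans (length-map suc (elements p)) (length-elements p)

∈-elements⁺ : ∀ {n} {p : Subset n} {x} → x ∈ p → x ∈ₗ elements p
∈-elements⁺ here = here refl
∈-elements⁺ {p = inside ∷ p}  (there x∈p) = there (∈-map⁺ suc (∈-elements⁺ x∈p))
∈-elements⁺ {p = outside ∷ p} (there x∈p) = ∈-map⁺ suc (∈-elements⁺ x∈p)

∈-elements⁻ : ∀ {n} {p : Subset n} {x} → x ∈ₗ elements p → x ∈ p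
∈-elements⁻ {p = inside ∷ p}  (here refl) = here
∈-elements⁻ {p = inside ∷ p}  (there x∈)  with _ , y∈ , refl ← ∈-map⁻ suc x∈ = there (∈-elements⁻ y∈)
∈-elements⁻ {p = outside ∷ p} x∈          with _ , y∈ , refl ← ∈-map⁻ suc x∈ = there (∈-elements⁻ y∈)

-- Walks, components and blocks

Adj-sym : ∀ {n} (K : Graph n) {a b} → Adj K a b → Adj K b a
Adj-sym K {a} {b} = subst T (Graph.sym K a b)

Adj-irrefl : ∀ {n} (K : Graph n) {a} → ¬ Adj K a a
Adj-irrefl K {a} = subst T (Graph.irrefl K a)

Adj⇒≢ : ∀ {n} (K : Graph n) {a b} → Adj K a b → a ≢ b
Adj⇒≢ K e refl = Adj-irrefl K e

Closed : ∀ {n} → Graph n → Subset n → Set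
Closed K C = ∀ {x z} → x ∈ C → Adj K x z → z ∈ C

module _ {n : ℕ} {K : Graph n} where

  walk-source : ∀ {S a b} → Walk K S a b → a ∈ S
  walk-source (here a∈S)     = a∈S
  walk-source (step a∈S _ _) = a∈S

  walk-target : ∀ {S a b} → Walk K S a b → b ∈ S
  walk-target (here b∈S)   = b∈S
  walk-target (step _ _ w) = walk-target w

  walk-mono : ∀ {S S′ a b} → S ⊆ S′ → Walk K S a b → Walk K S′ a b
  walk-mono S⊆S′ (here a∈S)     = here (S⊆S′ a∈S)
  walk-mono S⊆S′ (step a∈S e w) = step (S⊆S′ a∈S) e (walk-mono S⊆S′ w)

  walk-++ : ∀ {S a b c} → Walk K S a b → Walk K S b c → Walk K S a c
  walk-++ (here _)       w′ = w′
  walk-++ (step a∈S e w) w′ = step a∈S e (walk-++ w w′)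

  walk-snoc : ∀ {S a b c} → Walk K S a b → Adj K b c → c ∈ S → Walk K S a c
  walk-snoc w e c∈S = walk-++ w (step (walk-target w) e (here c∈S))

  walk-reverse : ∀ {S a b} → Walk K S a b → Walk K S b a
  walk-reverse (here a∈S)     = here a∈S
  walk-reverse (step a∈S e w) = walk-snoc (walk-reverse w) (Adj-sym K e) a∈S

  walk-firstStep : ∀ {S a b} → Walk K S a b → a ≢ b → ∃ λ x → Adj K a x × x ∈ S
  walk-firstStep (here _)     a≢a = contradiction refl a≢a
  walk-firstStep (step _ e w) _   = _ , e , walk-source w

  connected-via : ∀ {C c} → (∀ y → y ∈ C → Walk K C y c) → Connected K C
  connected-via toHub y z y∈C z∈C = walk-++ (toHub y y∈C) (walk-reverse (toHub z z∈C))

  closed-walk : ∀ {C S a b} → Closed K C → a ∈ C → Walk K S a b → b ∈ C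
  closed-walk closed a∈C (here _)     = a∈C
  closed-walk closed a∈C (step _ e w) = closed-walk closed (closed a∈C e) w

  closed⇒component : ∀ {C} → Nonempty C → Connected K C → Closed K C → Component K C
  closed⇒component (c , c∈C) connected closed =
    (c , c∈C) , connected , λ D C⊆D D-connected y∈D →
      closed-walk closed c∈C (D-connected _ _ (C⊆D c∈C) y∈D)

  component⇒closed : ∀ {C} → Component K C → Closed K C
  component⇒closed {C} (_ , connected , maximal) {x} {z} x∈C x~z =
    maximal (C ∪ ⁅ z ⁆) (p⊆p∪q ⁅ z ⁆) (connected-via toX) (q⊆p∪q C ⁅ z ⁆ (x∈⁅x⁆ z))
    where
    toX : ∀ y → y ∈ C ∪ ⁅ z ⁆ → Walk K (C ∪ ⁅ z ⁆) y x
    toX y y∈ with x∈p∪q⁻ C ⁅ z ⁆ y∈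
    ... | inj₁ y∈C = walk-mono (p⊆p∪q ⁅ z ⁆) (connected y x y∈C x∈C)
    ... | inj₂ y∈z with refl ← x∈⁅y⁆⇒x≡y z y∈z = step y∈ (Adj-sym K x~z) (here (p⊆p∪q ⁅ z ⁆ x∈C))

  component-≡ : ∀ {C C′ x} → Component K C → Component K C′ → x ∈ C → x ∈ C′ → C ≡ C′
  component-≡ C-comp@(_ , C-connected , _) C′-comp@(_ , C′-connected , _) x∈C x∈C′ = ⊆-antisym
    (λ y∈C → closed-walk (component⇒closed C′-comp) x∈C′ (C-connected _ _ x∈C y∈C))
    (λ y∈C′ → closed-walk (component⇒closed C-comp) x∈C (C′-connected _ _ x∈C′ y∈C′))

  -- Being connected, B cannot leave the closed set D that it meets.
  block-narrow : ∀ {D U B x} → Closed K D → D ⊆ U → Block K U B → x ∈ B → x ∈ D → Block K D B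
  block-narrow D-closed D⊆U (_ , B-nonempty , B-connected , B-noCut , maximal) x∈B x∈D =
    (λ y∈B → closed-walk D-closed x∈D (B-connected _ _ x∈B y∈B)) ,
    B-nonempty , B-connected , B-noCut , λ E B⊆E E⊆D → maximal E B⊆E (D⊆U ∘ E⊆D)

  -- v has a neighbour a in B. Any other w ∈ B - v is reached from v inside B - a, hence
  -- through a second neighbour b of v; but a and b are joined in B - v.
  atMostOne-minus-separating :
    ∀ {B v} → Connected K B → NoCutVertex K B → v ∈ B →
    (∀ {a b} → Adj K v a → Adj K v b → Walk K (B - v) a b → a ≡ b) → AtMostOne (B - v)
  atMostOne-minus-separating {B} {v} connected noCut v∈B separating {y} y∈B-v z∈B-v =
    trans (≡a y∈B-v) (sym (≡a z∈B-v))
    where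
    firstStep = walk-firstStep (connected v y v∈B (x∈p-y⇒x∈p y∈B-v)) (x∈p-y⇒x≢y y∈B-v ∘ sym)
    a = proj₁ firstStep
    v~a = proj₁ (proj₂ firstStep)
    a∈B-v = x∈p∧x≢y⇒x∈p-y (proj₂ (proj₂ firstStep)) (Adj⇒≢ K v~a ∘ sym)
    ≡a : ∀ {w} → w ∈ B - v → w ≡ a
    ≡a {w} w∈B-v with w ≟ a
    ... | yes w≡a = w≡a
    ... | no  w≢a =
      let b , v~b , b∈B-a = walk-firstStep (noCut a (x∈p-y⇒x∈p a∈B-v) v w v∈B-a w∈B-a)
                                           (x∈p-y⇒x≢y w∈B-v ∘ sym)
          b∈B-v = x∈p∧x≢y⇒x∈p-y (x∈p-y⇒x∈p b∈B-a) (Adj⇒≢ K v~b ∘ sym)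
      in contradiction (sym (separating v~a v~b (noCut v v∈B a b a∈B-v b∈B-v))) (x∈p-y⇒x≢y b∈B-a)
      where
      v∈B-a = x∈p∧x≢y⇒x∈p-y v∈B (Adj⇒≢ K v~a)
      w∈B-a = x∈p∧x≢y⇒x∈p-y (x∈p-y⇒x∈p w∈B-v) w≢a

  isCube⇒¬atMostOne-minus : ∀ {B} v → IsCube K B → ¬ AtMostOne (B - v)
  isCube⇒¬atMostOne-minus {B} v (f , f-injective , f∈B , _) atMostOne =
    let i , j , i≢j , fi≢v , fj≢v = twoAvoiding in
    i≢j (f-injective i j (atMostOne (x∈p∧x≢y⇒x∈p-y (f∈B i) fi≢v) (x∈p∧x≢y⇒x∈p-y (f∈B j) fj≢v)))
    where
    apart : ∀ i j → i ≢ j → f i ≡ v → f j ≢ v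
    apart i j i≢j fi≡v fj≡v = i≢j (f-injective i j (trans fi≡v (sym fj≡v)))
    twoAvoiding : ∃₂ λ i j → i ≢ j × f i ≢ v × f j ≢ v
    twoAvoiding with f 0F ≟ v | f 1F ≟ v
    ... | yes f0≡v | _        = 1F , 2F , (λ ()) , apart 0F 1F (λ ()) f0≡v , apart 0F 2F (λ ()) f0≡v
    ... | no  f0≢v | yes f1≡v = 0F , 2F , (λ ()) , f0≢v , apart 1F 2F (λ ()) f1≡v
    ... | no  f0≢v | no  f1≢v = 0F , 1F , (λ ()) , f0≢v , f1≢v

-- The components in Ds that meet a vertex list L are fewer than |L|, or one per vertex of L.
module NearComponents {n : ℕ} {K : Graph n} (Ds : List (Subset n))
                      (isComponent : ∀ {D} → D ∈ₗ Ds → Component K D) where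

  Covers : List (Fin n) → List (Subset n) → Set
  Covers L E = ∀ {D} → D ∈ₗ Ds → Any (_∈ D) L → D ∈ₗ E

  record Separated (L : List (Fin n)) (E : List (Subset n)) : Set where
    field
      ⊆Ds     : E ⊆ₗ Ds
      meets   : ∀ {D} → D ∈ₗ E → Any (_∈ D) L
      covered : ∀ {u} → u ∈ₗ L → Any (u ∈_) E
      apart   : ∀ {u u′ D} → u ∈ₗ L → u′ ∈ₗ L → D ∈ₗ Ds → u ∈ D → u′ ∈ D → u ≡ u′

  record Near (L : List (Fin n)) : Set where
    field
      near             : List (Subset n)
      covers           : Covers L near
      short            : length near ≤ length L
      fewerOrSeparated : suc (length near) ≤ length L ⊎ Separated L near

  same-component : ∀ {D D′ x} → D ∈ₗ Ds → D′ ∈ₗ Ds → x ∈ D → x ∈ D′ → D ≡ D′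
  same-component D∈Ds D′∈Ds = component-≡ (isComponent D∈Ds) (isComponent D′∈Ds)

  separated-[] : Separated [] []
  separated-[] = record { ⊆Ds = λ () ; meets = λ () ; covered = λ () ; apart = λ () }

  separated-∷ : ∀ {a L E D} → D ∈ₗ Ds → a ∈ D → ¬ D ∈ₗ E →
                Separated L E → Separated (a ∷ L) (D ∷ E)
  separated-∷ {a} {L} {E} {D} D∈Ds a∈D D∉E sep = record
    { ⊆Ds     = λ { (here refl) → D∈Ds ; (there D′∈E) → ⊆Ds D′∈E }
    ; meets   = λ { (here refl) → here a∈D ; (there D′∈E) → there (meets D′∈E) }
    ; covered = λ { (here refl) → here a∈D ; (there u∈L) → there (covered u∈L) }
    ; apart   = λ { (here refl) (here refl) _ _ _ → refl
                  ; (here refl) (there u′∈L) D′∈Ds a∈D′ u′∈D′ →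
                      contradiction (D∈E u′∈L D′∈Ds a∈D′ u′∈D′) D∉E
                  ; (there u∈L) (here refl) D′∈Ds u∈D′ a∈D′ →
                      contradiction (D∈E u∈L D′∈Ds a∈D′ u∈D′) D∉E
                  ; (there u∈L) (there u′∈L) → apart u∈L u′∈L }
    }
    where
    open Separated sep
    D∈E : ∀ {u D′} → u ∈ₗ L → D′ ∈ₗ Ds → a ∈ D′ → u ∈ D′ → D ∈ₗ E
    D∈E u∈L D′∈Ds a∈D′ u∈D′ with D₁ , D₁∈E , u∈D₁ ← find (covered u∈L) =
      subst (_∈ₗ E) (trans (same-component (⊆Ds D₁∈E) D′∈Ds u∈D₁ u∈D′)
                           (same-component D′∈Ds D∈Ds a∈D′ a∈D)) D₁∈E

  near-unchanged : ∀ {a L} (N : Near L) → Covers (a ∷ L) (Near.near N) → Near (a ∷ L)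
  near-unchanged N covers = record
    { near = near ; covers = covers ; short = m≤n⇒m≤1+n short ; fewerOrSeparated = inj₁ (s≤s short) }
    where open Near N hiding (covers)

  nearComponents : ∀ L → Near L
  nearComponents [] = record
    { near = [] ; covers = λ _ () ; short = z≤n ; fewerOrSeparated = inj₂ separated-[] }
  nearComponents (a ∷ L) with nearComponents L | any? (a ∈?_) Ds
  ... | N | no a∉Ds = near-unchanged N λ
    { D∈Ds (here a∈D) → contradiction (lose D∈Ds a∈D) a∉Ds
    ; D∈Ds (there L-meets-D) → Near.covers N D∈Ds L-meets-D }
  ... | N | yes a∈Ds with D , D∈Ds , a∈D ← find a∈Ds | any? (≡-dec Bool._≟_ D) (Near.near N)
  ...   | yes D∈near = near-unchanged N λ
    { D′∈Ds (here a∈D′) → subst (_∈ₗ Near.near N) (same-component D∈Ds D′∈Ds a∈D a∈D′) D∈near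
    ; D′∈Ds (there L-meets-D′) → Near.covers N D′∈Ds L-meets-D′ }
  ...   | no D∉near = record
    { near             = D ∷ near
    ; covers           = λ { D′∈Ds (here a∈D′) → here (same-component D′∈Ds D∈Ds a∈D′ a∈D)
                           ; D′∈Ds (there L-meets-D′) → there (covers D′∈Ds L-meets-D′) }
    ; short            = s≤s short
    ; fewerOrSeparated = Sum.map s≤s (separated-∷ D∈Ds a∈D D∉near) fewerOrSeparated
    }
    where open Near N

-- Deleting a vertex

removeVertex : ∀ {m} → Graph (suc m) → Fin (suc m) → Graph m
removeVertex G v = record
  { adj    = λ i j → adj G (punchIn v i) (punchIn v j)
  ; sym    = λ i j → Graph.sym G (punchIn v i) (punchIn v j)
  ; irrefl = λ i → Graph.irrefl G (punchIn v i)
  }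

DifficultComponent : ∀ {n} → Graph n → Subset n → Set
DifficultComponent K C = Component K C × Difficult K C

DifficultBlocks : ∀ {n} → Graph n → Subset n → Set
DifficultBlocks K C = ∀ B → Block K C B → ∣ B ∣ ≡ 1 ⊎ ∣ B ∣ ≡ 2 ⊎ IsCube K B

DisjointCubeBlocks : ∀ {n} → Graph n → Subset n → Set
DisjointCubeBlocks K C = ∀ B B′ → Block K C B → Block K C B′ → IsCube K B → IsCube K B′ → B ≢ B′ →
                         ∀ x → x ∈ B → x ∈ B′ → Empty

bound-insert : ∀ n s e k d k′ → 6 * n ≤ 5 * s + e + k → suc k ≤ k′ + d →
               6 * suc n ≤ 5 * suc s + (e + d) + k′
bound-insert n s e k d k′ bound count = begin
  6 * suc n                  ≡⟨ *-suc 6 n ⟩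
  6 + 6 * n                  ≤⟨ +-monoʳ-≤ 6 bound ⟩
  6 + (5 * s + e + k)        ≡⟨ solve 3 (λ s e k → con 6 :+ (con 5 :* s :+ e :+ k)
                                     := con 5 :* (con 1 :+ s) :+ e :+ (con 1 :+ k)) refl s e k ⟩
  5 * suc s + e + suc k      ≤⟨ +-monoʳ-≤ (5 * suc s + e) count ⟩
  5 * suc s + e + (k′ + d)   ≡⟨ solve 4 (λ s e k′ d → s :+ e :+ (k′ :+ d) := s :+ (e :+ d) :+ k′)
                                        refl (5 * suc s) e k′ d ⟩
  5 * suc s + (e + d) + k′   ∎
  where
  open ≤-Reasoning
  open +-*-Solver

module VertexDeletion {m : ℕ} (G : Graph (suc m)) (v : Fin (suc m)) where

  H : Graph m
  H = removeVertex G v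

  φ : Fin m → Fin (suc m)
  φ = punchIn v

  φ-injective : ∀ {a b} → φ a ≡ φ b → a ≡ b
  φ-injective = punchIn-injective v _ _

  data Vertex : Fin (suc m) → Set where
    deleted : Vertex v
    kept    : ∀ a → Vertex (φ a)

  vertex : ∀ y → Vertex y
  vertex y with y ≟ v
  ... | yes refl = deleted
  ... | no  y≢v  = subst Vertex (punchIn-punchOut (y≢v ∘ sym)) (kept (punchOut (y≢v ∘ sym)))

  lift : Subset m → Subset (suc m)
  lift S = insertAt S v outside

  ∈-insertAt⁺ : ∀ {S β x} → x ∈ S → φ x ∈ insertAt S v β
  ∈-insertAt⁺ {S} {β} {x} x∈S =
    lookup⇒[]= (φ x) (insertAt S v β) (trans (insertAt-punchIn S v β x) ([]=⇒lookup x∈S))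

  ∈-insertAt⁻ : ∀ {S β x} → φ x ∈ insertAt S v β → x ∈ S
  ∈-insertAt⁻ {S} {β} {x} φx∈ =
    lookup⇒[]= x S (trans (sym (insertAt-punchIn S v β x)) ([]=⇒lookup φx∈))

  v∈insertAt : ∀ {S} → v ∈ insertAt S v inside
  v∈insertAt {S} = lookup⇒[]= v (insertAt S v inside) (insertAt-lookup S v inside)

  v∉lift : ∀ {S} → v ∉ lift S
  v∉lift {S} v∈ with () ← trans (sym (insertAt-lookup S v outside)) ([]=⇒lookup v∈)

  preimage : ∀ {S β y} → y ∈ insertAt S v β → y ≢ v → ∃ λ a → φ a ≡ y × a ∈ S
  preimage {y = y} y∈ y≢v with vertex y
  ... | deleted = contradiction refl y≢v
  ... | kept a  = a , refl , ∈-insertAt⁻ y∈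

  preimage-lift : ∀ {S y} → y ∈ lift S → ∃ λ a → φ a ≡ y × a ∈ S
  preimage-lift y∈ = preimage y∈ λ { refl → v∉lift y∈ }

  lift-⊆ : ∀ {S T β} → S ⊆ T → lift S ⊆ insertAt T v β
  lift-⊆ S⊆T y∈ with _ , refl , a∈S ← preimage-lift y∈ = ∈-insertAt⁺ (S⊆T a∈S)

  data Lifted : Subset (suc m) → Set where
    lifted : ∀ B → Lifted (lift B)

  toLifted : ∀ {B} → v ∉ B → Lifted B
  toLifted {B} v∉B =
    subst Lifted (trans (cong (insertAt (removeAt B v) v) lookup≡outside) (insertAt-removeAt B v))
      (lifted (removeAt B v))
    where
    lookup≡outside : outside ≡ lookup B v
    lookup≡outside with lookup B v in eq
    ... | inside  = contradiction (lookup⇒[]= v B eq) v∉B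
    ... | outside = refl

  lift-minus : ∀ {S x} → lift (S - x) ≡ lift S - φ x
  lift-minus = ⊆-antisym
    (λ y∈ → let a , φa≡y , a∈S-x = preimage-lift y∈ in
      subst (_∈ _) φa≡y (x∈p∧x≢y⇒x∈p-y (∈-insertAt⁺ (x∈p-y⇒x∈p a∈S-x)) (x∈p-y⇒x≢y a∈S-x ∘ φ-injective)))
    (λ y∈ → let a , φa≡y , a∈S = preimage-lift (x∈p-y⇒x∈p y∈) in
      subst (_∈ _) φa≡y (∈-insertAt⁺ (x∈p∧x≢y⇒x∈p-y a∈S
        λ a≡x → x∈p-y⇒x≢y y∈ (trans (sym φa≡y) (cong φ a≡x)))))

  walk-lift : ∀ {S β a b} → Walk H S a b → Walk G (insertAt S v β) (φ a) (φ b)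
  walk-lift (here a∈S)     = here (∈-insertAt⁺ a∈S)
  walk-lift (step a∈S e w) = step (∈-insertAt⁺ a∈S) e (walk-lift w)

  walk-unlift : ∀ {S x y} → Walk G (lift S) x y → ∀ {a b} → x ≡ φ a → y ≡ φ b → Walk H S a b
  walk-unlift (here x∈) refl y≡φb with refl ← φ-injective y≡φb = here (∈-insertAt⁻ x∈)
  walk-unlift (step x∈ e w) refl y≡φb with _ , refl , _ ← preimage-lift (walk-source w) =
    step (∈-insertAt⁻ x∈) e (walk-unlift w refl y≡φb)

  connected-lift : ∀ {S} → Connected H S → Connected G (lift S)
  connected-lift S-connected x y x∈ y∈
    with _ , refl , a∈S ← preimage-lift x∈ | _ , refl , b∈S ← preimage-lift y∈ =
    walk-lift (S-connected _ _ a∈S b∈S)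

  connected-unlift : ∀ {S} → Connected G (lift S) → Connected H S
  connected-unlift connected a b a∈S b∈S =
    walk-unlift (connected (φ a) (φ b) (∈-insertAt⁺ a∈S) (∈-insertAt⁺ b∈S)) refl refl

  noCutVertex-lift : ∀ {S} → NoCutVertex H S → NoCutVertex G (lift S)
  noCutVertex-lift noCut y y∈ with _ , refl , a∈S ← preimage-lift y∈ =
    subst (Connected G) lift-minus (connected-lift (noCut _ a∈S))

  noCutVertex-unlift : ∀ {S} → NoCutVertex G (lift S) → NoCutVertex H S
  noCutVertex-unlift noCut a a∈S =
    connected-unlift (subst (Connected G) (sym lift-minus) (noCut (φ a) (∈-insertAt⁺ a∈S)))

  isCube-lift : ∀ {S} → IsCube H S → IsCube G (lift S)
  isCube-lift (f , f-injective , f∈S , f-onto , f-adj) =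
    φ ∘ f , (λ i j → f-injective i j ∘ φ-injective) , ∈-insertAt⁺ ∘ f∈S , onto , f-adj
    where
    onto : ∀ y → y ∈ _ → ∃ λ i → φ (f i) ≡ y
    onto y y∈ with a , refl , a∈S ← preimage-lift y∈ = let i , fi≡a = f-onto a a∈S in i , cong φ fi≡a

  isCube-unlift : ∀ {S} → IsCube G (lift S) → IsCube H S
  isCube-unlift (f , f-injective , f∈ , f-onto , f-adj) = g , g-injective , g∈S , g-onto , g-adj
    where
    g : Fin 8 → Fin m
    g i = proj₁ (preimage-lift (f∈ i))
    φg≡f : ∀ i → φ (g i) ≡ f i
    φg≡f i = proj₁ (proj₂ (preimage-lift (f∈ i)))
    g-injective : ∀ i j → g i ≡ g j → i ≡ j
    g-injective i j gi≡gj = f-injective i j (trans (sym (φg≡f i)) (trans (cong φ gi≡gj) (φg≡f j)))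
    g∈S : ∀ i → g i ∈ _
    g∈S i = proj₂ (proj₂ (preimage-lift (f∈ i)))
    g-onto : ∀ a → a ∈ _ → ∃ λ i → g i ≡ a
    g-onto a a∈S = let i , fi≡φa = f-onto (φ a) (∈-insertAt⁺ a∈S) in
                   i , φ-injective (trans (φg≡f i) fi≡φa)
    g-adj : ∀ i j → adj G (φ (g i)) (φ (g j)) ≡ cubeAdj i j
    g-adj i j = trans (cong₂ (adj G) (φg≡f i) (φg≡f j)) (f-adj i j)

  block-unlift : ∀ {U β B} → Block G (insertAt U v β) (lift B) → Block H U B
  block-unlift (B⊆C , (y , y∈B) , connected , noCut , maximal) =
    ∈-insertAt⁻ ∘ B⊆C ∘ ∈-insertAt⁺ ,
    (let a , _ , a∈B = preimage-lift y∈B in a , a∈B) ,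
    connected-unlift connected , noCutVertex-unlift noCut ,
    λ E B⊆E E⊆U E-connected E-noCut →
      ∈-insertAt⁻
      ∘ maximal (lift E) (lift-⊆ B⊆E) (lift-⊆ E⊆U)
                (connected-lift E-connected) (noCutVertex-lift E-noCut)
      ∘ ∈-insertAt⁺

  difficultBlock-lift : ∀ {U β B} → DifficultBlocks H U → Block G (insertAt U v β) (lift B) →
                        ∣ lift B ∣ ≡ 1 ⊎ ∣ lift B ∣ ≡ 2 ⊎ IsCube G (lift B)
  difficultBlock-lift {B = B} blocks block rewrite ∣insertAt-outside∣ B v =
    Sum.map₂ (Sum.map₂ isCube-lift) (blocks B (block-unlift block))

  disjointCubeBlocks-lift : ∀ {U β} → DisjointCubeBlocks H U →
                            (∀ {B} → Block G (insertAt U v β) B → IsCube G B → v ∉ B) →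
                            DisjointCubeBlocks G (insertAt U v β)
  disjointCubeBlocks-lift disjoint avoids B B′ block block′ cube cube′ B≢B′ x x∈B x∈B′
    with toLifted (avoids block cube) | toLifted (avoids block′ cube′)
  ... | lifted B₁ | lifted B₂ with a , refl , a∈B₁ ← preimage-lift x∈B =
    disjoint B₁ B₂ (block-unlift block) (block-unlift block′)
      (isCube-unlift cube) (isCube-unlift cube′)
      (B≢B′ ∘ cong lift) a a∈B₁ (∈-insertAt⁻ x∈B′)

  difficultComponent-far : ∀ {D} → DifficultComponent H D → (∀ {x} → x ∈ D → ¬ Adj G v (φ x)) →
                           DifficultComponent G (lift D)
  difficultComponent-far {D} (D-component , (a , a∈D) , D-connected , blocks , disjoint) far =
    closed⇒component nonempty connected closed , nonempty , connected , blocks′ ,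
    disjointCubeBlocks-lift disjoint (λ block _ → avoids block)
    where
    nonempty : Nonempty (lift D)
    nonempty = φ a , ∈-insertAt⁺ a∈D
    connected = connected-lift D-connected
    closed : Closed G (lift D)
    closed {y} {z} y∈ y~z with _ , refl , b∈D ← preimage-lift y∈ | vertex z
    ... | deleted = contradiction (Adj-sym G y~z) (far b∈D)
    ... | kept c  = ∈-insertAt⁺ (component⇒closed D-component b∈D y~z)
    avoids : ∀ {B} → Block G (lift D) B → v ∉ B
    avoids block v∈B = v∉lift (proj₁ block v∈B)
    blocks′ : DifficultBlocks G (lift D)
    blocks′ B block with toLifted (avoids block)
    ... | lifted _ = difficultBlock-lift blocks block

  -- The blocks through the cut vertex v are single edges.
  difficultComponent-glue :
    ∀ {U} → Closed H U → (∀ {x} → Adj G v (φ x) → x ∈ U) →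
    (∀ {x} → x ∈ U → ∃ λ u → Adj G v (φ u) × Walk H U x u) →
    (∀ {a b} → Adj G v (φ a) → Adj G v (φ b) → Walk H U a b → a ≡ b) →
    DifficultBlocks H U → DisjointCubeBlocks H U → DifficultComponent G (insertAt U v inside)
  difficultComponent-glue {U} U-closed neighbours⊆U reaches separating blocks disjoint =
    closed⇒component nonempty connected closed , nonempty , connected , blocks′ ,
    disjointCubeBlocks-lift disjoint
      (λ block cube v∈B → isCube⇒¬atMostOne-minus {K = G} v cube (small block v∈B))
    where
    C = insertAt U v inside
    nonempty : Nonempty C
    nonempty = v , v∈insertAt
    toV : ∀ y → y ∈ C → Walk G C y v
    toV y y∈ with vertex y
    ... | deleted = here y∈
    ... | kept a with u , v~u , w ← reaches (∈-insertAt⁻ y∈) =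
      walk-snoc (walk-lift w) (Adj-sym G v~u) v∈insertAt
    connected = connected-via toV
    closed : Closed G C
    closed {y} {z} y∈ y~z with vertex y | vertex z
    ... | deleted | deleted = contradiction y~z (Adj-irrefl G)
    ... | deleted | kept c  = ∈-insertAt⁺ (neighbours⊆U y~z)
    ... | kept a  | deleted = v∈insertAt
    ... | kept a  | kept c  = ∈-insertAt⁺ (U-closed (∈-insertAt⁻ y∈) y~z)
    small : ∀ {B} → Block G C B → v ∈ B → AtMostOne (B - v)
    small {B} (B⊆C , _ , B-connected , noCut , _) v∈B =
      atMostOne-minus-separating B-connected noCut v∈B separating′
      where
      B-v⊆U : B - v ⊆ lift U
      B-v⊆U y∈ = let a , φa≡y , a∈U = preimage (B⊆C (x∈p-y⇒x∈p y∈)) (x∈p-y⇒x≢y y∈) in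
                 subst (_∈ lift U) φa≡y (∈-insertAt⁺ a∈U)
      separating′ : ∀ {a b} → Adj G v a → Adj G v b → Walk G (B - v) a b → a ≡ b
      separating′ {a} {b} v~a v~b w with vertex a | vertex b
      ... | deleted | _       = contradiction v~a (Adj-irrefl G)
      ... | kept _  | deleted = contradiction v~b (Adj-irrefl G)
      ... | kept _  | kept _  = cong φ (separating v~a v~b (walk-unlift (walk-mono B-v⊆U w) refl refl))
    blocks′ : DifficultBlocks G C
    blocks′ B block with v ∈? B
    ... | yes v∈B = Sum.map₂ inj₁ (≡1+≤1⇒≡1⊎≡2 (∣p∣≡1+∣p-x∣ v∈B) (∣p∣≤1 (small block v∈B)))
    ... | no v∉B with toLifted v∉B
    ...   | lifted _ = difficultBlock-lift blocks block

  Nᵥ : Subset m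
  Nᵥ = tabulate (adj G v ∘ φ)

  N≡liftNᵥ : N G v ≡ lift Nᵥ
  N≡liftNᵥ = ⊆-antisym to from
    where
    to : N G v ⊆ lift Nᵥ
    to {y} y∈N with vertex y
    ... | deleted = contradiction (∈-tabulate⁻ {f = adj G v} y∈N) (Adj-irrefl G)
    ... | kept a  = ∈-insertAt⁺ (∈-tabulate⁺ {f = adj G v ∘ φ} (∈-tabulate⁻ {f = adj G v} y∈N))
    from : lift Nᵥ ⊆ N G v
    from y∈ with a , refl , a∈Nᵥ ← preimage-lift y∈ =
      ∈-tabulate⁺ {f = adj G v} (∈-tabulate⁻ {f = adj G v ∘ φ} a∈Nᵥ)

  deg≡∣Nᵥ∣ : deg G v ≡ ∣ Nᵥ ∣
  deg≡∣Nᵥ∣ = trans (cong ∣_∣ N≡liftNᵥ) (∣insertAt-outside∣ Nᵥ v)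

  neighbours : List (Fin m)
  neighbours = elements Nᵥ

  ∈-neighbours⁺ : ∀ {x} → Adj G v (φ x) → x ∈ₗ neighbours
  ∈-neighbours⁺ = ∈-elements⁺ ∘ ∈-tabulate⁺ {f = adj G v ∘ φ}

  ∈-neighbours⁻ : ∀ {x} → x ∈ₗ neighbours → Adj G v (φ x)
  ∈-neighbours⁻ = ∈-tabulate⁻ {f = adj G v ∘ φ} ∘ ∈-elements⁻

  length-neighbours : length neighbours ≡ deg G v
  length-neighbours = trans (length-elements Nᵥ) (sym deg≡∣Nᵥ∣)

  lift-injective : ∀ {S T} → lift S ≡ lift T → S ≡ T
  lift-injective {S} {T} eq =
    trans (sym (removeAt-insertAt S v outside))
          (trans (cong (λ X → removeAt X v) eq) (removeAt-insertAt T v outside))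

  module _ {Ds : List (Subset m)} (Ds-unique : Unique Ds)
           (Ds-difficult : ∀ D → (D ∈ₗ Ds) ⇔ DifficultComponent H D)
           {Cs : List (Subset (suc m))} (Cs-difficult : ∀ C → (C ∈ₗ Cs) ⇔ DifficultComponent G C) where

    difficult : ∀ {D} → D ∈ₗ Ds → DifficultComponent H D
    difficult = Equivalence.to (Ds-difficult _)

    open NearComponents {K = H} Ds (proj₁ ∘ difficult)

    lifted-Ds⊆ : ∀ {E} → Covers neighbours E → map lift Ds ⊆ₗ Cs ++ map lift E
    lifted-Ds⊆ covers p∈ with D , D∈Ds , refl ← ∈-map⁻ lift p∈ with any? (_∈? D) neighbours
    ... | yes meets = ∈-++⁺ʳ Cs (∈-map⁺ lift (covers D∈Ds meets))
    ... | no ¬meets = ∈-++⁺ˡ (Equivalence.from (Cs-difficult _) (difficultComponent-far (difficult D∈Ds)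
                        λ x∈D v~φx → ¬meets (lose (∈-neighbours⁺ v~φx) x∈D)))

    length-lifted-Ds≤ : ∀ {E Vs} → Unique (Vs ++ map lift Ds) → Vs ⊆ₗ Cs → Covers neighbours E →
                        length Vs + length Ds ≤ length Cs + length E
    length-lifted-Ds≤ {E} {Vs} unique Vs⊆Cs covers = begin
      length Vs + length Ds              ≡⟨ cong (length Vs +_) (sym (length-map lift Ds)) ⟩
      length Vs + length (map lift Ds)   ≡⟨ sym (length-++ Vs) ⟩
      length (Vs ++ map lift Ds)         ≤⟨ unique-⊆⇒length≤ unique ⊆Cs++ ⟩
      length (Cs ++ map lift E)          ≡⟨ length-++ Cs ⟩
      length Cs + length (map lift E)    ≡⟨ cong (length Cs +_) (length-map lift E) ⟩
      length Cs + length E               ∎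
      where
      open ≤-Reasoning
      ⊆Cs++ : Vs ++ map lift Ds ⊆ₗ Cs ++ map lift E
      ⊆Cs++ p∈ with ∈-++⁻ Vs p∈
      ... | inj₁ p∈Vs = ∈-++⁺ˡ (Vs⊆Cs p∈Vs)
      ... | inj₂ p∈Ds = lifted-Ds⊆ covers p∈Ds

    difficultComponent-glued : ∀ {E} → Separated neighbours E →
                               DifficultComponent G (insertAt (⋃ E) v inside)
    difficultComponent-glued {E} separated =
      difficultComponent-glue closed neighbours⊆⋃ reaches separating blocks disjoint
      where
      open Separated separated
      component : ∀ {D} → D ∈ₗ E → Component H D
      component = proj₁ ∘ difficult ∘ ⊆Ds
      blocksOf : ∀ {D} → D ∈ₗ E → DifficultBlocks H D × DisjointCubeBlocks H D
      blocksOf D∈E = let _ , _ , _ , blocks , disjoint = difficult (⊆Ds D∈E) in blocks , disjoint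
      closed : Closed H (⋃ E)
      closed x∈ x~z with D , D∈E , x∈D ← find (∈⋃⁻ E x∈) =
        ⊆⋃ D∈E (component⇒closed (component D∈E) x∈D x~z)
      neighbours⊆⋃ : ∀ {x} → Adj G v (φ x) → x ∈ ⋃ E
      neighbours⊆⋃ v~x with D , D∈E , x∈D ← find (covered (∈-neighbours⁺ v~x)) = ⊆⋃ D∈E x∈D
      reaches : ∀ {x} → x ∈ ⋃ E → ∃ λ u → Adj G v (φ u) × Walk H (⋃ E) x u
      reaches x∈ with D , D∈E , x∈D ← find (∈⋃⁻ E x∈) with u , u∈neighbours , u∈D ← find (meets D∈E) =
        let _ , D-connected , _ = component D∈E in
        u , ∈-neighbours⁻ u∈neighbours , walk-mono (⊆⋃ D∈E) (D-connected _ u x∈D u∈D)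
      separating : ∀ {a b} → Adj G v (φ a) → Adj G v (φ b) → Walk H (⋃ E) a b → a ≡ b
      separating v~a v~b w with D , D∈E , a∈D ← find (covered (∈-neighbours⁺ v~a)) =
        apart (∈-neighbours⁺ v~a) (∈-neighbours⁺ v~b) (⊆Ds D∈E) a∈D
              (closed-walk (component⇒closed (component D∈E)) a∈D w)
      narrow : ∀ {B D x} → D ∈ₗ E → Block H (⋃ E) B → x ∈ B → x ∈ D → Block H D B
      narrow D∈E = block-narrow (component⇒closed (component D∈E)) (⊆⋃ D∈E)
      blocks : DifficultBlocks H (⋃ E)
      blocks B block@(B⊆⋃ , (x , x∈B) , _) with D , D∈E , x∈D ← find (∈⋃⁻ E (B⊆⋃ x∈B)) =
        proj₁ (blocksOf D∈E) B (narrow D∈E block x∈B x∈D)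
      disjoint : DisjointCubeBlocks H (⋃ E)
      disjoint B B′ block block′ cube cube′ B≢B′ x x∈B x∈B′
        with D , D∈E , x∈D ← find (∈⋃⁻ E (proj₁ block x∈B)) =
        proj₂ (blocksOf D∈E) B B′
          (narrow D∈E block x∈B x∈D) (narrow D∈E block′ x∈B′ x∈D) cube cube′ B≢B′ x x∈B x∈B′

    lift-Ds-unique : Unique (map lift Ds)
    lift-Ds-unique = Unique.map⁺ lift-injective Ds-unique

    numDifficult-bound : suc (length Ds) ≤ length Cs + deg G v
    numDifficult-bound with nearComponents neighbours
    ... | record { near = E ; covers = covers ; fewerOrSeparated = inj₁ fewer } = begin
      suc (length Ds)                ≤⟨ s≤s (length-lifted-Ds≤ lift-Ds-unique (λ ()) covers) ⟩
      suc (length Cs + length E)     ≡⟨ sym (+-suc (length Cs) (length E)) ⟩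
      length Cs + suc (length E)     ≤⟨ +-monoʳ-≤ (length Cs) fewer ⟩
      length Cs + length neighbours  ≡⟨ cong (length Cs +_) length-neighbours ⟩
      length Cs + deg G v            ∎
      where open ≤-Reasoning
    ... | record { near = E ; covers = covers ; short = short ; fewerOrSeparated = inj₂ separated } =
      begin
      suc (length Ds)                ≤⟨ length-lifted-Ds≤ C∷lift-Ds-unique [C]⊆Cs covers ⟩
      length Cs + length E           ≤⟨ +-monoʳ-≤ (length Cs) short ⟩
      length Cs + length neighbours  ≡⟨ cong (length Cs +_) length-neighbours ⟩
      length Cs + deg G v            ∎
      where
      open ≤-Reasoning
      C = insertAt (⋃ E) v inside
      [C]⊆Cs : C ∷ [] ⊆ₗ Cs
      [C]⊆Cs (here refl) = Equivalence.from (Cs-difficult C) (difficultComponent-glued separated)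
      C≢lifted : ∀ {p} → p ∈ₗ map lift Ds → C ≢ p
      C≢lifted p∈ C≡p with _ , _ , refl ← ∈-map⁻ lift p∈ = v∉lift (subst (v ∈_) C≡p v∈insertAt)
      C∷lift-Ds-unique : Unique (C ∷ map lift Ds)
      C∷lift-Ds-unique = All.tabulate C≢lifted ∷ lift-Ds-unique

  numDifficult-removeVertex : ∀ {kH kG} → NumDifficult H kH → NumDifficult G kG → suc kH ≤ kG + deg G v
  numDifficult-removeVertex (_ , Ds-unique , refl , Ds-difficult) (_ , _ , refl , Cs-difficult) =
    numDifficult-bound Ds-unique Ds-difficult Cs-difficult

  triangleFree-removeVertex : TriangleFree G → TriangleFree H
  triangleFree-removeVertex triangleFree a b c = triangleFree (φ a) (φ b) (φ c)

  minorModel-lift : ∀ {k} {h : Fin k → Fin k → Bool} → MinorModel H h → MinorModel G h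
  minorModel-lift M = record
    { branch    = lift ∘ branch
    ; nonempty  = λ i → let x , x∈ = nonempty i in φ x , ∈-insertAt⁺ x∈
    ; connected = connected-lift ∘ connected
    ; disjoint  = disjoint′
    ; edges     = λ i j ij → let x , y , x∈ , y∈ , x~y = edges i j ij in
                    φ x , φ y , ∈-insertAt⁺ x∈ , ∈-insertAt⁺ y∈ , x~y
    }
    where
    open MinorModel M
    disjoint′ : ∀ i j → i ≢ j → ∀ y → y ∈ lift (branch i) → y ∈ lift (branch j) → Empty
    disjoint′ i j i≢j y y∈i y∈j with a , refl , a∈i ← preimage-lift y∈i =
      disjoint i j i≢j a a∈i (∈-insertAt⁻ y∈j)

  planar-removeVertex : Planar G → Planar H
  planar-removeVertex (noK5 , noK33) = noK5 ∘ minorModel-lift , noK33 ∘ minorModel-lift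

  twoDegenerate-insert : ∀ {S} → deg G v ≤ 2 → TwoDegenerate H S → TwoDegenerate G (insertAt S v inside)
  twoDegenerate-insert deg≤2 S-degenerate T T⊆ (y , y∈T) with v ∈? T
  ... | yes v∈T = v , v∈T , ≤-trans (∣p∩q∣≤∣p∣ (N G v) T) deg≤2
  ... | no  v∉T with toLifted v∉T
  ...   | lifted T′
    with a , refl , a∈T′ ← preimage-lift y∈T
    with w , w∈T′ , degIn≤2 ← S-degenerate T′ (∈-insertAt⁻ ∘ T⊆ ∘ ∈-insertAt⁺) (a , a∈T′) =
    φ w , ∈-insertAt⁺ w∈T′ , subst (_≤ 2) (sym (∣tabulate∩insertAt-outside∣ (adj G (φ w)) T′ v)) degIn≤2

  edgeCount-removeVertex : edgeCount G ≡ edgeCount H + deg G v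
  edgeCount-removeVertex = begin
    edgeCount G
      ≡⟨ edgeCount≡∑ G ⟩
    sum (λ w → sum (lower G w))
      ≡⟨ sum-remove {i = v} (λ w → sum (lower G w)) ⟩
    sum (lower G v) + sum (λ i → sum (lower G (φ i)))
      ≡⟨ cong₂ _+_ lower-v (sum-cong-≗ lower-φ) ⟩
    sum below + sum (λ i → above i + sum (lower H i))
      ≡⟨ cong (sum below +_) (∑-distrib-+ above _) ⟩
    sum below + (sum above + sum (λ i → sum (lower H i)))
      ≡⟨ sym (+-assoc (sum below) (sum above) _) ⟩
    sum below + sum above + sum (λ i → sum (lower H i))
      ≡⟨ +-comm (sum below + sum above) _ ⟩
    sum (λ i → sum (lower H i)) + (sum below + sum above)
      ≡⟨ cong₂ _+_ (sym (edgeCount≡∑ H)) (sym (∑-distrib-+ below above)) ⟩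
    edgeCount H + sum (λ j → below j + above j)
      ≡⟨ cong (edgeCount H +_) (sum-cong-≗ λ j → indicator-split (adj G v (φ j)) (φ≢v j)) ⟩
    edgeCount H + sum (indicator ∘ adj G v ∘ φ)
      ≡⟨ cong (edgeCount H +_) (sym (trans deg≡∣Nᵥ∣ (∣tabulate∣ (adj G v ∘ φ)))) ⟩
    edgeCount H + deg G v
      ∎
    where
    open ≡-Reasoning
    lower : ∀ {k} → Graph k → Fin k → Fin k → ℕ
    lower K w u = indicator (adj K w u ∧ (toℕ u <ᵇ toℕ w))
    edgeCount≡∑ : ∀ {k} (K : Graph k) → edgeCount K ≡ sum (λ w → sum (lower K w))
    edgeCount≡∑ {k} K =
      trans (sum-tabulate {k} _) (sum-cong-≗ {k} λ w → ∣tabulate∣ (λ u → adj K w u ∧ (toℕ u <ᵇ toℕ w)))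
    below above : Fin m → ℕ
    below j = indicator (adj G v (φ j) ∧ (toℕ (φ j) <ᵇ toℕ v))
    above j = indicator (adj G v (φ j) ∧ (toℕ v <ᵇ toℕ (φ j)))
    φ≢v : ∀ j → toℕ (φ j) ≢ toℕ v
    φ≢v j = punchInᵢ≢i v j ∘ toℕ-injective
    lower-v : sum (lower G v) ≡ sum below
    lower-v = trans (sum-remove {i = v} (lower G v))
                    (cong (λ b → indicator (b ∧ _) + sum below) (Graph.irrefl G v))
    lower-φ : ∀ i → sum (lower G (φ i)) ≡ above i + sum (lower H i)
    lower-φ i = trans (sum-remove {i = v} (lower G (φ i))) (cong₂ _+_
      (cong (λ b → indicator (b ∧ _)) (Graph.sym G (φ i) v))
      (sum-cong-≗ λ j → cong (λ b → indicator (adj G (φ i) (φ j) ∧ b)) (punchIn-<ᵇ v j i)))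

  satisfiesBound-insert : deg G v ≤ 2 → SatisfiesBound H → ∃ (NumDifficult H) → SatisfiesBound G
  satisfiesBound-insert deg≤2 H-bound (kH , H-count) kG G-count =
    let S , S-degenerate , S-bound = H-bound kH H-count in
    insertAt S v inside , twoDegenerate-insert deg≤2 S-degenerate ,
    subst₂ (λ s e → 6 * suc m ≤ 5 * s + e + kG)
      (sym (∣insertAt-inside∣ S v)) (sym edgeCount-removeVertex)
      (bound-insert m ∣ S ∣ (edgeCount H) kH (deg G v) kG S-bound
         (numDifficult-removeVertex H-count G-count))

lemma2p4 : (n : ℕ) (G : Graph n) → MinimalCounterexample G → (v : Fin n) → 3 ≤ deg G v
lemma2p4 zero    G _ ()
lemma2p4 (suc m) G (triangleFree , planar , unbounded , minimal) v with 3 ≤? deg G v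
... | yes 3≤deg = 3≤deg
... | no  3≰deg =
  ⊥-elim (¬¬-decidable m (DifficultComponent H) λ difficult? →
    let Ds , Ds-unique , Ds-difficult = enumerate difficult? in
    unbounded (satisfiesBound-insert (≤-pred (≰⇒> 3≰deg))
      (minimal m ≤-refl H (triangleFree-removeVertex triangleFree) (planar-removeVertex planar))
      (length Ds , Ds , Ds-unique , refl , Ds-difficult)))
  where open VertexDeletion G v
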